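{- With $C_i=\binom{2i}{i}/(i+1)$, $$Q(1,u)=\sum_{i,j\ge0}\binom{2i+2j}{2i}C_iC_ju^{i+j}=\sum_{n\ge0}C_nC_{n+1}u^n,\qquad Q(1,s,u)=\sum_{i,j\ge0}\binom{2i+2j}{2i}C_iC_js^iu^{i+j},$$ and $$Q(-1,s,u)=\sum_{i,j\ge0}\binom{i+j}{i}C_iC_js^iu^{i+j}.$$
   Context: Quarter plane loops are square lattice walks with steps $\mathsf E=(1,0)$, $\mathsf N=(0,1)$, $\mathsf W=(-1,0)$, $\mathsf S=(0,-1)$ starting and ending at $(0,0)$ and staying in $\{x\ge0,y\ge0\}$. $Q(a,s,u)=\sum_w a^{c(w)}s^{e(w)}u^{|w|/2}$ over quarter plane loops $w$, where $|w|$ is the length, $e(w)$ the number of $\mathsf E$ steps, and $c(w)$ the number of $\mathsf{NW}$ factors plus $\mathsf{ES}$ factors ($\mathsf N$ immediately followed by $\mathsf W$, resp. $\mathsf E$ immediately followed by $\mathsf S$). $Q(a,u)=Q(a,1,u)$. -}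

module Defs where

open import Data.Bool using (Bool; true; false; _∧_)
open import Data.Nat using (ℕ; zero; suc; _+_; _*_; _/_; _≡ᵇ_)
open import Data.Nat.Combinatorics using (_C_)
open import Data.List using (List; []; _∷_; map; concatMap; filterᵇ; foldr)
open import Data.Integer as ℤ using (ℤ)

-- Steps E=(1,0), N=(0,1), W=(-1,0), S=(0,-1)
data Step : Set where
  E N W S : Step

allSteps : List Step
allSteps = E ∷ N ∷ W ∷ S ∷ []

words : ℕ → List (List Step)
words zero = [] ∷ []
words (suc m) = concatMap (λ w → map (λ st → st ∷ w) allSteps) (words m)

-- stays x y w : the walk w started at (x,y) stays in the quarter plane
-- and ends at (0,0)
stays : ℕ → ℕ → List Step → Bool
stays zero zero [] = true
stays zero (suc y) [] = false
stays (suc x) y [] = false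
stays x y (E ∷ w) = stays (suc x) y w
stays x y (N ∷ w) = stays x (suc y) w
stays zero y (W ∷ w) = false
stays (suc x) y (W ∷ w) = stays x y w
stays x zero (S ∷ w) = false
stays x (suc y) (S ∷ w) = stays x y w

isLoop : List Step → Bool
isLoop = stays 0 0

eSteps : List Step → ℕ
eSteps [] = 0
eSteps (E ∷ w) = suc (eSteps w)
eSteps (N ∷ w) = eSteps w
eSteps (W ∷ w) = eSteps w
eSteps (S ∷ w) = eSteps w

cFactors : List Step → ℕ
cFactors [] = 0
cFactors (N ∷ W ∷ w) = suc (cFactors (W ∷ w))
cFactors (E ∷ S ∷ w) = suc (cFactors (S ∷ w))
cFactors (N ∷ w) = cFactors w
cFactors (E ∷ w) = cFactors w
cFactors (W ∷ w) = cFactors w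
cFactors (S ∷ w) = cFactors w

sumℤ : List ℤ → ℤ
sumℤ = foldr ℤ._+_ (ℤ.+ 0)

-- coefficient of s^i u^n in Q(a,s,u): sum of a^{c(w)} over quarter plane
-- loops w of length 2n with e(w) = i
Qcoeff : ℤ → ℕ → ℕ → ℤ
Qcoeff a i n =
  sumℤ (map (λ w → a ℤ.^ cFactors w)
            (filterᵇ (λ w → isLoop w ∧ (eSteps w ≡ᵇ i)) (words (2 * n))))

-- coefficient of u^n in Q(a,u) = Q(a,1,u): sum of a^{c(w)} over quarter
-- plane loops w of length 2n
QcoeffU : ℤ → ℕ → ℤ
QcoeffU a n =
  sumℤ (map (λ w → a ℤ.^ cFactors w) (filterᵇ isLoop (words (2 * n))))

catalan : ℕ → ℕ
catalan i = ((2 * i) C i) / suc i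

-- A walk from (x, y) to the origin in the quarter plane is a shuffle of a horizontal ballot path
-- (E and W steps) and a vertical one (N and S steps).  Weight each walk with i east and n north steps
-- by a ^ c, also counting a factor NW or ES formed with a virtual preceding step p.  Removing the first
-- step gives a linear recurrence for these weighted sums, solved by B(x, i) B(y, n) g(x, y, i, n) plus
-- correction terms for p; here B are ballot numbers and g is any function obeying four shuffle
-- recurrences (one for each pair of first letters of the two paths) with boundary value 1.  For a = 1,
-- g = binom(2i + x + 2n + y, 2i + x) counts the shuffles; for a = −1, g is a signed coefficient of
-- (1 + t)^(i+n) (1 − t)^(i+x+n+y), which at x = y = 0 is binom(i + n, i).  As B(0, i) is the Catalan
-- number C_i, this gives the coefficients of Q(±1, s, u); summing over i, a Vandermonde convolution
-- gives C_n C_{n+1}.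
module Submission where

module ListSums where

  open import Data.Bool using (Bool; true; false; _∧_; if_then_else_)
  open import Data.Nat as ℕ using (ℕ; zero; suc)
  open import Data.List using (List; []; _∷_; map; concatMap; filterᵇ; _++_; applyUpTo)
  open import Data.Integer using (ℤ; +_; _+_; _*_)
  open import Data.Integer.Properties using (+-identityˡ; +-identityʳ; +-assoc; *-zeroʳ; *-distribˡ-+; +-commutativeSemigroup)
  open import Algebra.Properties.CommutativeSemigroup +-commutativeSemigroup using (interchange)
  open import Relation.Binary.PropositionalEquality
  open import Defs using (sumℤ)

  private variable A B : Set

  sumOver : List A → (A → ℤ) → ℤ
  sumOver l f = sumℤ (map f l)

  sumOver-filterᵇ : (P : A → Bool) (f : A → ℤ) (l : List A) →
    sumOver (filterᵇ P l) f ≡ sumOver l (λ w → if P w then f w else + 0)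
  sumOver-filterᵇ P f [] = refl
  sumOver-filterᵇ P f (x ∷ l) with P x
  ... | true  = cong (_+_ (f x)) (sumOver-filterᵇ P f l)
  ... | false = trans (sumOver-filterᵇ P f l) (sym (+-identityˡ _))

  sumOver-++ : (l₁ l₂ : List A) (f : A → ℤ) → sumOver (l₁ ++ l₂) f ≡ sumOver l₁ f + sumOver l₂ f
  sumOver-++ []       l₂ f = sym (+-identityˡ _)
  sumOver-++ (x ∷ l₁) l₂ f = trans (cong (_+_ (f x)) (sumOver-++ l₁ l₂ f)) (sym (+-assoc (f x) _ _))

  sumOver-concatMap : (F : A → List B) (f : B → ℤ) (l : List A) →
    sumOver (concatMap F l) f ≡ sumOver l (λ x → sumOver (F x) f)
  sumOver-concatMap F f []      = refl
  sumOver-concatMap F f (x ∷ l) =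
    trans (sumOver-++ (F x) (concatMap F l) f) (cong (_+_ (sumOver (F x) f)) (sumOver-concatMap F f l))

  sumOver-cong : (l : List A) {f g : A → ℤ} → (∀ x → f x ≡ g x) → sumOver l f ≡ sumOver l g
  sumOver-cong []      f≗g = refl
  sumOver-cong (x ∷ l) f≗g = cong₂ _+_ (f≗g x) (sumOver-cong l f≗g)

  sumOver-+ : (l : List A) (f g : A → ℤ) → sumOver l (λ x → f x + g x) ≡ sumOver l f + sumOver l g
  sumOver-+ []      f g = refl
  sumOver-+ (x ∷ l) f g = trans (cong (_+_ (f x + g x)) (sumOver-+ l f g)) (interchange (f x) (g x) _ _)

  sumOver-*ˡ : (l : List A) (c : ℤ) (f : A → ℤ) → sumOver l (λ x → c * f x) ≡ c * sumOver l f
  sumOver-*ˡ []      c f = sym (*-zeroʳ c)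
  sumOver-*ˡ (x ∷ l) c f = trans (cong (_+_ (c * f x)) (sumOver-*ˡ l c f)) (sym (*-distribˡ-+ c (f x) _))

  sumOver-zero : (l : List A) → sumOver l (λ _ → + 0) ≡ + 0
  sumOver-zero []      = refl
  sumOver-zero (x ∷ l) = trans (+-identityˡ _) (sumOver-zero l)

  sumOver-comm : (l : List A) (k : List B) (f : A → B → ℤ) →
    sumOver l (λ x → sumOver k (f x)) ≡ sumOver k (λ y → sumOver l (λ x → f x y))
  sumOver-comm []      k f = sym (sumOver-zero k)
  sumOver-comm (x ∷ l) k f =
    trans (cong (_+_ (sumOver k (f x))) (sumOver-comm l k f)) (sym (sumOver-+ k (f x) _))

  sumℤ< : ℕ → (ℕ → ℤ) → ℤ
  sumℤ< zero    f = + 0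
  sumℤ< (suc n) f = f 0 + sumℤ< n (λ i → f (suc i))

  sumOver-applyUpTo : (f : ℕ → ℤ) (g : ℕ → ℕ) (n : ℕ) → sumOver (applyUpTo g n) f ≡ sumℤ< n (λ i → f (g i))
  sumOver-applyUpTo f g zero    = refl
  sumOver-applyUpTo f g (suc n) = cong (_+_ (f (g 0))) (sumOver-applyUpTo f (λ i → g (suc i)) n)

  sumℤ<-zero : ∀ n → sumℤ< n (λ _ → + 0) ≡ + 0
  sumℤ<-zero zero    = refl
  sumℤ<-zero (suc n) = trans (+-identityˡ _) (sumℤ<-zero n)

  sumℤ<-indicator : ∀ b h e n → (b ≡ true → e ℕ.≤ n) →
    sumℤ< (suc n) (λ i → if b ∧ (e ℕ.≡ᵇ i) then h else + 0) ≡ (if b then h else + 0)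
  sumℤ<-indicator false h e n _     = sumℤ<-zero (suc n)
  sumℤ<-indicator true  h e n e≤n = at e n (e≤n refl)
    where
    at : ∀ e n → e ℕ.≤ n → sumℤ< (suc n) (λ i → if e ℕ.≡ᵇ i then h else + 0) ≡ h
    at zero    n       _         = trans (cong (_+_ h) (sumℤ<-zero n)) (+-identityʳ h)
    at (suc e) (suc n) (ℕ.s≤s e≤n) = trans (+-identityˡ _) (at e n e≤n)

module Binomials where

  open import Data.Nat using (suc; _+_; _*_; _∸_; _!)
  open import Data.Nat.Properties using (m≤m+n; m+n∸m≡n; _!*_!≢0; *-cancelʳ-≡; +-suc)
  open import Data.Nat.Combinatorics using (_C_; nCk≡n!/k![n-k]!; k![n∸k]!∣n!; nCk≡nC[n∸k]; nCk+nC[k+1]≡[n+1]C[k+1])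
  open import Data.Nat.Tactic.RingSolver using (solve-∀)
  open import Data.Nat.DivMod using (m/n*n≡m)
  open import Relation.Binary.PropositionalEquality

  C-factorial : ∀ k m → ((k + m) C k) * (k ! * m !) ≡ (k + m) !
  C-factorial k m = subst (λ d → ((k + m) C k) * (k ! * d !) ≡ (k + m) !) (m+n∸m≡n k m) divides
    where
    instance _ = k !* (k + m ∸ k) !≢0
    divides : ((k + m) C k) * (k ! * (k + m ∸ k) !) ≡ (k + m) !
    divides = trans (cong (_* (k ! * (k + m ∸ k) !)) (nCk≡n!/k![n-k]! (m≤m+n k m))) (m/n*n≡m (k![n∸k]!∣n! (m≤m+n k m)))

  C-symmetric : ∀ k m → (k + m) C k ≡ (k + m) C m
  C-symmetric k m = trans (nCk≡nC[n∸k] (m≤m+n k m)) (cong ((k + m) C_) (m+n∸m≡n k m))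

  C-suc : ∀ {n n′} k → n ≡ suc n′ → n C suc k ≡ n′ C k + n′ C suc k
  C-suc {n′ = n′} k refl = sym (nCk+nC[k+1]≡[n+1]C[k+1] n′ k)

  C-ratio : ∀ k m → ((k + suc m) C k) * suc m ≡ ((k + suc m) C suc k) * suc k
  C-ratio k m = *-cancelʳ-≡ _ _ (k ! * m !) (trans via-C-k (sym via-C-suc-k))
    where
    instance _ = k !* m !≢0
    via-C-k : ((k + suc m) C k) * suc m * (k ! * m !) ≡ (k + suc m) !
    via-C-k = trans (regroup ((k + suc m) C k) (suc m) (k !) (m !)) (C-factorial k (suc m))
      where
      regroup : ∀ c s f g → c * s * (f * g) ≡ c * (f * (s * g))
      regroup = solve-∀
    via-C-suc-k : ((k + suc m) C suc k) * suc k * (k ! * m !) ≡ (k + suc m) !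
    via-C-suc-k = trans (regroup ((k + suc m) C suc k) (suc k) (k !) (m !))
      (subst (λ n → (n C suc k) * (suc k ! * m !) ≡ n !) (sym (+-suc k m)) (C-factorial (suc k) m))
      where
      regroup : ∀ c s f g → c * s * (f * g) ≡ c * (s * f * g)
      regroup = solve-∀

module Ballot where

  open import Defs using (catalan)
  open Binomials
  open import Data.Nat using (ℕ; zero; suc; _+_; _*_)
  open import Data.Nat.Properties using (+-identityʳ; +-assoc; +-suc; +-cancelʳ-≡; +-commutativeSemigroup)
  open import Data.Nat.Combinatorics using (_C_; nCk+nC[k+1]≡[n+1]C[k+1])
  open import Data.Nat.DivMod using (_/_; m*n/n≡m)
  open import Data.Nat.Tactic.RingSolver using (solve-∀)
  open import Algebra.Properties.CommutativeSemigroup +-commutativeSemigroup using (interchange)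
  open import Relation.Binary.PropositionalEquality
  open ≡-Reasoning

  -- ballot x i counts the paths with i up and i + x down steps from height x to 0 that stay at height ≥ 0.
  ballot : ℕ → ℕ → ℕ
  ballot zero    zero    = 1
  ballot (suc x) zero    = ballot x zero
  ballot zero    (suc i) = ballot 1 i
  ballot (suc x) (suc i) = ballot (suc (suc x)) i + ballot x (suc i)

  atOrigin startUp startDown : ℕ → ℕ → ℕ
  atOrigin zero    zero    = 1
  atOrigin zero    (suc i) = 0
  atOrigin (suc x) i       = 0
  startUp   x       zero    = 0
  startUp   x       (suc i) = ballot (suc x) i
  startDown zero    i       = 0
  startDown (suc x) i       = ballot x i

  ballot-first-step : ∀ x i → ballot x i ≡ atOrigin x i + startUp x i + startDown x i
  ballot-first-step zero    zero    = refl
  ballot-first-step (suc x) zero    = refl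
  ballot-first-step zero    (suc i) = sym (+-identityʳ (ballot 1 i))
  ballot-first-step (suc x) (suc i) = refl

  ballot-horizontal : ∀ x → ballot x 0 ≡ 1
  ballot-horizontal zero    = refl
  ballot-horizontal (suc x) = ballot-horizontal x

  -- The reflection principle, in subtraction-free form.
  ballot-reflection : ∀ x i {L} → L ≡ suc i + suc i + x → ballot x (suc i) + L C i ≡ L C suc i
  ballot-reflection zero    zero    refl = refl
  ballot-reflection (suc x) zero    refl =
    trans (cong (λ b → b + ballot x 1 + 1) (ballot-horizontal (suc (suc x))))
      (trans (cong suc (ballot-reflection x zero refl)) (nCk+nC[k+1]≡[n+1]C[k+1] (suc (suc x)) 0))
  ballot-reflection zero    (suc i) refl = begin
      ballot 1 (suc i) + L C suc i
    ≡⟨ cong (ballot 1 (suc i) +_) (C-suc i L≡1+L′) ⟩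
      ballot 1 (suc i) + (L′ C i + L′ C suc i)
    ≡⟨ sym (+-assoc (ballot 1 (suc i)) (L′ C i) (L′ C suc i)) ⟩
      ballot 1 (suc i) + L′ C i + L′ C suc i
    ≡⟨ cong (_+ L′ C suc i) (ballot-reflection 1 i (two-ways i)) ⟩
      L′ C suc i + L′ C suc i
    ≡⟨ cong (L′ C suc i +_) (C-symmetric (suc i) (suc (suc i))) ⟩
      L′ C suc i + L′ C suc (suc i)
    ≡⟨ sym (C-suc (suc i) L≡1+L′) ⟩
      L C suc (suc i)
    ∎
    where
    L L′ : ℕ
    L = suc (suc i) + suc (suc i) + 0
    L′ = suc i + suc (suc i)
    L≡1+L′ : L ≡ suc L′
    L≡1+L′ = +-identityʳ _
    two-ways : ∀ i → suc i + suc (suc i) ≡ suc i + suc i + 1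
    two-ways = solve-∀
  ballot-reflection (suc x) (suc i) refl = begin
      ballot (suc (suc x)) (suc i) + ballot x (suc (suc i)) + L C suc i
    ≡⟨ cong (ballot (suc (suc x)) (suc i) + ballot x (suc (suc i)) +_) (C-suc i (L≡1+L′ i x)) ⟩
      ballot (suc (suc x)) (suc i) + ballot x (suc (suc i)) + (L′ C i + L′ C suc i)
    ≡⟨ interchange (ballot (suc (suc x)) (suc i)) (ballot x (suc (suc i))) (L′ C i) (L′ C suc i) ⟩
      ballot (suc (suc x)) (suc i) + L′ C i + (ballot x (suc (suc i)) + L′ C suc i)
    ≡⟨ cong₂ _+_ (ballot-reflection (suc (suc x)) i (two-ways i x)) (ballot-reflection x (suc i) refl) ⟩
      L′ C suc i + L′ C suc (suc i)
    ≡⟨ sym (C-suc (suc i) (L≡1+L′ i x)) ⟩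
      L C suc (suc i)
    ∎
    where
    L L′ : ℕ
    L = suc (suc i) + suc (suc i) + suc x
    L′ = suc (suc i) + suc (suc i) + x
    L≡1+L′ : ∀ i x → suc (suc i) + suc (suc i) + suc x ≡ suc (suc (suc i) + suc (suc i) + x)
    L≡1+L′ = solve-∀
    two-ways : ∀ i x → suc (suc i) + suc (suc i) + x ≡ suc i + suc i + suc (suc x)
    two-ways = solve-∀

  ballot-central : ∀ i → ballot 0 i * suc i ≡ (i + i) C i
  ballot-central zero    = refl
  ballot-central (suc k) =
    cancel (ballot 0 (suc k)) (L C k) (L C suc k) k (ballot-reflection 0 k (sym (+-identityʳ L)))
      (subst (λ n → (n C k) * suc (suc k) ≡ (n C suc k) * suc k) (+-suc k (suc k)) (C-ratio k (suc k)))
    where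
    L : ℕ
    L = suc k + suc k
    cancel : ∀ b c₀ c₁ k → b + c₀ ≡ c₁ → c₀ * suc (suc k) ≡ c₁ * suc k → b * suc (suc k) ≡ c₁
    cancel b c₀ _ k refl h = +-cancelʳ-≡ ((b + c₀) * suc k) (b * suc (suc k)) (b + c₀)
      (trans (cong (b * suc (suc k) +_) (sym h)) (expand b c₀ k))
      where
      expand : ∀ b c₀ k → b * suc (suc k) + c₀ * suc (suc k) ≡ b + c₀ + (b + c₀) * suc k
      expand = solve-∀

  catalan≡ballot : ∀ i → catalan i ≡ ballot 0 i
  catalan≡ballot i = begin
      ((i + (i + 0)) C i) / suc i
    ≡⟨ cong (λ n → (n C i) / suc i) (cong (i +_) (+-identityʳ i)) ⟩
      ((i + i) C i) / suc i
    ≡⟨ cong (_/ suc i) (sym (ballot-central i)) ⟩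
      (ballot 0 i * suc i) / suc i
    ≡⟨ m*n/n≡m (ballot 0 i) (suc i) ⟩
      ballot 0 i
    ∎

  catalan-central : ∀ i → catalan i * suc i ≡ (i + i) C i
  catalan-central i = trans (cong (_* suc i) (catalan≡ballot i)) (ballot-central i)

module Walks where

  open import Defs
  open ListSums
  open import Data.Bool using (true; false; _∧_; if_then_else_)
  open import Data.Bool.Properties using (∧-zeroʳ)
  open import Data.Nat using (ℕ; zero; suc; _+_; _≡ᵇ_; _<_; _≤_; z≤n; s≤s)
  import Data.Nat as ℕ
  open import Data.Nat.Properties using (≤-pred; m≤n⇒m≤1+n; <⇒≤; +-suc; +-identityʳ; +-mono-<)
  open import Data.List.Relation.Unary.All as All using (All; []; _∷_)
  open import Data.List.Relation.Unary.All.Properties using (concat⁺; map⁺)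
  import Data.Nat.Tactic.RingSolver as ℕ-Solver
  open import Data.Product using (_×_; _,_)
  open import Data.List using (List; []; _∷_; length; map)
  open import Data.Integer using (ℤ; +_; _*_; _^_) renaming (_+_ to _+ℤ_)
  open import Data.Integer.Properties using (*-identityˡ; *-zeroʳ) renaming (+-identityʳ to +ℤ-identityʳ)
  open import Relation.Binary.PropositionalEquality

  stays-E : ∀ x y w → stays x y (E ∷ w) ≡ stays (suc x) y w
  stays-E zero    zero    w = refl
  stays-E zero    (suc y) w = refl
  stays-E (suc x) zero    w = refl
  stays-E (suc x) (suc y) w = refl

  stays-N : ∀ x y w → stays x y (N ∷ w) ≡ stays x (suc y) w
  stays-N zero    zero    w = refl
  stays-N zero    (suc y) w = refl
  stays-N (suc x) zero    w = refl
  stays-N (suc x) (suc y) w = refl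

  stays-W-zero : ∀ y w → stays zero y (W ∷ w) ≡ false
  stays-W-zero zero    w = refl
  stays-W-zero (suc y) w = refl

  stays-W-suc : ∀ x y w → stays (suc x) y (W ∷ w) ≡ stays x y w
  stays-W-suc x zero    w = refl
  stays-W-suc x (suc y) w = refl

  stays-S-zero : ∀ x w → stays x zero (S ∷ w) ≡ false
  stays-S-zero zero    w = refl
  stays-S-zero (suc x) w = refl

  stays-S-suc : ∀ x y w → stays x (suc y) (S ∷ w) ≡ stays x y w
  stays-S-suc zero    y w = refl
  stays-S-suc (suc x) y w = refl

  stays⇒eSteps≤length : ∀ x y w → stays x y w ≡ true → eSteps w + eSteps w + x ≤ length w
  stays⇒eSteps≤length zero    zero    []      _ = z≤n
  stays⇒eSteps≤length x       y       (E ∷ w) h =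
    subst (_≤ suc (length w)) (two-more (eSteps w) x)
      (s≤s (stays⇒eSteps≤length (suc x) y w (trans (sym (stays-E x y w)) h)))
    where
    two-more : ∀ e x → suc (e + e + suc x) ≡ suc e + suc e + x
    two-more = ℕ-Solver.solve-∀
  stays⇒eSteps≤length x       y       (N ∷ w) h =
    m≤n⇒m≤1+n (stays⇒eSteps≤length x (suc y) w (trans (sym (stays-N x y w)) h))
  stays⇒eSteps≤length zero    y       (W ∷ w) h with () ← trans (sym (stays-W-zero y w)) h
  stays⇒eSteps≤length (suc x) y       (W ∷ w) h =
    subst (_≤ suc (length w)) (sym (+-suc _ x))
      (s≤s (stays⇒eSteps≤length x y w (trans (sym (stays-W-suc x y w)) h)))
  stays⇒eSteps≤length x       zero    (S ∷ w) h with () ← trans (sym (stays-S-zero x w)) h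
  stays⇒eSteps≤length x       (suc y) (S ∷ w) h =
    m≤n⇒m≤1+n (stays⇒eSteps≤length x y w (trans (sym (stays-S-suc x y w)) h))

  -- A walk from (x, y) to the origin with i east and n north steps has i + x west and n + y south steps.
  walkLength : ℕ → ℕ → ℕ → ℕ → ℕ
  walkLength x y i n = i + i + x + (n + n + y)

  walkLength-E : ∀ x y i n → walkLength x y (suc i) n ≡ suc (walkLength (suc x) y i n)
  walkLength-E = unfolded
    where
    unfolded : ∀ x y i n → suc i + suc i + x + (n + n + y) ≡ suc (i + i + suc x + (n + n + y))
    unfolded = ℕ-Solver.solve-∀

  walkLength-N : ∀ x y i n → walkLength x y i (suc n) ≡ suc (walkLength x (suc y) i n)
  walkLength-N = unfolded
    where
    unfolded : ∀ x y i n → i + i + x + (suc n + suc n + y) ≡ suc (i + i + x + (n + n + suc y))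
    unfolded = ℕ-Solver.solve-∀

  walkLength-W : ∀ x y i n → walkLength (suc x) y i n ≡ suc (walkLength x y i n)
  walkLength-W = unfolded
    where
    unfolded : ∀ x y i n → i + i + suc x + (n + n + y) ≡ suc (i + i + x + (n + n + y))
    unfolded = ℕ-Solver.solve-∀

  walkLength-S : ∀ x y i n → walkLength x (suc y) i n ≡ suc (walkLength x y i n)
  walkLength-S = unfolded
    where
    unfolded : ∀ x y i n → i + i + x + (n + n + suc y) ≡ suc (i + i + x + (n + n + y))
    unfolded = ℕ-Solver.solve-∀

  walkLength≡0 : ∀ x y i n → walkLength x y i n ≡ 0 → x ≡ 0 × y ≡ 0 × i ≡ 0 × n ≡ 0
  walkLength≡0 zero    zero    zero    zero    _  = refl , refl , refl , refl
  walkLength≡0 x       y       (suc i) n       ()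
  walkLength≡0 (suc x) y       zero    n       ()
  walkLength≡0 zero    y       zero    (suc n) ()
  walkLength≡0 zero    (suc y) zero    zero    ()

  walkLength-origin : ∀ i j → walkLength 0 0 i j ≡ 2 ℕ.* (i + j)
  walkLength-origin = unfolded
    where
    unfolded : ∀ i j → i + i + 0 + (j + j + 0) ≡ 2 ℕ.* (i + j)
    unfolded = ℕ-Solver.solve-∀

  words-length : ∀ m → All (λ w → length w ≡ m) (words m)
  words-length zero    = refl ∷ []
  words-length (suc m) =
    concat⁺ (map⁺ (All.map (λ len → cong suc len ∷ cong suc len ∷ cong suc len ∷ cong suc len ∷ []) (words-length m)))

  module Weighted (a : ℤ) where

    pairWeight : Step → Step → ℤ
    pairWeight p E = + 1
    pairWeight p N = + 1
    pairWeight N W = a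
    pairWeight E S = a
    pairWeight _ _ = + 1

    ^-cFactors-∷ : ∀ p q w → a ^ cFactors (p ∷ q ∷ w) ≡ pairWeight p q * a ^ cFactors (q ∷ w)
    ^-cFactors-∷ N W w = refl
    ^-cFactors-∷ E S w = refl
    ^-cFactors-∷ E E w = sym (*-identityˡ _)
    ^-cFactors-∷ E N w = sym (*-identityˡ _)
    ^-cFactors-∷ E W w = sym (*-identityˡ _)
    ^-cFactors-∷ N E w = sym (*-identityˡ _)
    ^-cFactors-∷ N N w = sym (*-identityˡ _)
    ^-cFactors-∷ N S w = sym (*-identityˡ _)
    ^-cFactors-∷ W E w = sym (*-identityˡ _)
    ^-cFactors-∷ W N w = sym (*-identityˡ _)
    ^-cFactors-∷ W W w = sym (*-identityˡ _)
    ^-cFactors-∷ W S w = sym (*-identityˡ _)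
    ^-cFactors-∷ S E w = sym (*-identityˡ _)
    ^-cFactors-∷ S N w = sym (*-identityˡ _)
    ^-cFactors-∷ S W w = sym (*-identityˡ _)
    ^-cFactors-∷ S S w = sym (*-identityˡ _)

    -- The step p is a virtual predecessor of w: a factor NW or ES across it counts.
    loopWeight : Step → ℕ → ℕ → ℕ → List Step → ℤ
    loopWeight p x y i w = if stays x y w ∧ (eSteps w ≡ᵇ i) then a ^ cFactors (p ∷ w) else + 0

    walkSum : Step → ℕ → ℕ → ℕ → ℕ → ℤ
    walkSum p x y i m = sumOver (words m) (loopWeight p x y i)

    Continuation : Set
    Continuation = Step → ℕ → ℕ → ℕ → ℤ

    east west south : Continuation → Continuation
    east  f p x       y       zero    = + 0
    east  f p x       y       (suc i) = pairWeight p E * f E (suc x) y i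
    west  f p zero    y       i       = + 0
    west  f p (suc x) y       i       = pairWeight p W * f W x y i
    south f p x       zero    i       = + 0
    south f p x       (suc y) i       = pairWeight p S * f S x y i

    stepSum : Continuation → Continuation
    stepSum f p x y i = east f p x y i +ℤ (pairWeight p N * f N x (suc y) i +ℤ (west f p x y i +ℤ south f p x y i))

    sumOver-east : ∀ {A} (l : List A) (F : A → Continuation) p x y i →
      sumOver l (λ w → east (F w) p x y i) ≡ east (λ q x y i → sumOver l (λ w → F w q x y i)) p x y i
    sumOver-east l F p x y zero    = sumOver-zero l
    sumOver-east l F p x y (suc i) = sumOver-*ˡ l (pairWeight p E) _

    sumOver-west : ∀ {A} (l : List A) (F : A → Continuation) p x y i →
      sumOver l (λ w → west (F w) p x y i) ≡ west (λ q x y i → sumOver l (λ w → F w q x y i)) p x y i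
    sumOver-west l F p zero    y i = sumOver-zero l
    sumOver-west l F p (suc x) y i = sumOver-*ˡ l (pairWeight p W) _

    sumOver-south : ∀ {A} (l : List A) (F : A → Continuation) p x y i →
      sumOver l (λ w → south (F w) p x y i) ≡ south (λ q x y i → sumOver l (λ w → F w q x y i)) p x y i
    sumOver-south l F p x zero    i = sumOver-zero l
    sumOver-south l F p x (suc y) i = sumOver-*ˡ l (pairWeight p S) _

    sumOver-stepSum : ∀ {A} (l : List A) (F : A → Continuation) p x y i →
      sumOver l (λ w → stepSum (F w) p x y i) ≡ stepSum (λ q x y i → sumOver l (λ w → F w q x y i)) p x y i
    sumOver-stepSum l F p x y i = begin
        sumOver l (λ w → stepSum (F w) p x y i)
      ≡⟨ sumOver-+ l _ _ ⟩
        sumOver l (λ w → east (F w) p x y i)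
          +ℤ sumOver l (λ w → pairWeight p N * F w N x (suc y) i +ℤ (west (F w) p x y i +ℤ south (F w) p x y i))
      ≡⟨ cong₂ _+ℤ_ (sumOver-east l F p x y i) (trans (sumOver-+ l _ _)
           (cong₂ _+ℤ_ (sumOver-*ˡ l (pairWeight p N) _) (trans (sumOver-+ l _ _)
             (cong₂ _+ℤ_ (sumOver-west l F p x y i) (sumOver-south l F p x y i))))) ⟩
        stepSum (λ q x y i → sumOver l (λ w → F w q x y i)) p x y i
      ∎
      where open ≡-Reasoning

    if-*ˡ : ∀ b c z → (if b then c * z else + 0) ≡ c * (if b then z else + 0)
    if-*ˡ true  c z = refl
    if-*ˡ false c z = sym (*-zeroʳ c)

    continuations : List Step → Continuation
    continuations w q x y i = loopWeight q x y i w

    loopWeight-E : ∀ p x y i w → loopWeight p x y i (E ∷ w) ≡ east (continuations w) p x y i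
    loopWeight-E p x y zero    w rewrite stays-E x y w | ∧-zeroʳ (stays (suc x) y w) = refl
    loopWeight-E p x y (suc i) w rewrite stays-E x y w | ^-cFactors-∷ p E w =
      if-*ˡ (stays (suc x) y w ∧ (eSteps w ≡ᵇ i)) (pairWeight p E) (a ^ cFactors (E ∷ w))

    loopWeight-N : ∀ p x y i w → loopWeight p x y i (N ∷ w) ≡ pairWeight p N * continuations w N x (suc y) i
    loopWeight-N p x y i w rewrite stays-N x y w | ^-cFactors-∷ p N w =
      if-*ˡ (stays x (suc y) w ∧ (eSteps w ≡ᵇ i)) (pairWeight p N) (a ^ cFactors (N ∷ w))

    loopWeight-W : ∀ p x y i w → loopWeight p x y i (W ∷ w) ≡ west (continuations w) p x y i
    loopWeight-W p zero    y i w rewrite stays-W-zero y w = refl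
    loopWeight-W p (suc x) y i w rewrite stays-W-suc x y w | ^-cFactors-∷ p W w =
      if-*ˡ (stays x y w ∧ (eSteps w ≡ᵇ i)) (pairWeight p W) (a ^ cFactors (W ∷ w))

    loopWeight-S : ∀ p x y i w → loopWeight p x y i (S ∷ w) ≡ south (continuations w) p x y i
    loopWeight-S p x zero    i w rewrite stays-S-zero x w = refl
    loopWeight-S p x (suc y) i w rewrite stays-S-suc x y w | ^-cFactors-∷ p S w =
      if-*ˡ (stays x y w ∧ (eSteps w ≡ᵇ i)) (pairWeight p S) (a ^ cFactors (S ∷ w))

    walkSum-suc : ∀ p x y i m → walkSum p x y i (suc m) ≡ stepSum (λ q x y i → walkSum q x y i m) p x y i
    walkSum-suc p x y i m = begin
        walkSum p x y i (suc m)
      ≡⟨ sumOver-concatMap _ (loopWeight p x y i) (words m) ⟩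
        sumOver (words m) (λ w → sumOver (map (_∷ w) allSteps) (loopWeight p x y i))
      ≡⟨ sumOver-cong (words m) (λ w → cong₂ _+ℤ_ (loopWeight-E p x y i w) (cong₂ _+ℤ_ (loopWeight-N p x y i w)
           (cong₂ _+ℤ_ (loopWeight-W p x y i w) (trans (+ℤ-identityʳ _) (loopWeight-S p x y i w))))) ⟩
        sumOver (words m) (λ w → stepSum (continuations w) p x y i)
      ≡⟨ sumOver-stepSum (words m) continuations p x y i ⟩
        stepSum (λ q x y i → walkSum q x y i m) p x y i
      ∎
      where open ≡-Reasoning

    private
      east-bound : ∀ i x y → suc i + suc i + x + y ≡ suc (i + i + suc x + y)
      east-bound = ℕ-Solver.solve-∀
      west-bound : ∀ i x y → i + i + suc x + y ≡ suc (i + i + x + y)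
      west-bound = ℕ-Solver.solve-∀
      south-bound : ∀ i x y → i + i + x + suc y ≡ suc (i + i + x + y)
      south-bound = ℕ-Solver.solve-∀

    stepSum-vanishes : ∀ m (f : Continuation) p x y i →
      (∀ q x y i → m < i + i + x + y → f q x y i ≡ + 0) →
      suc m < i + i + x + y → stepSum f p x y i ≡ + 0
    stepSum-vanishes m f p x y i f-short short =
      cong₂ _+ℤ_ (east-vanishes i short)
        (cong₂ _+ℤ_ north-vanishes (cong₂ _+ℤ_ (west-vanishes x short) (south-vanishes y short)))
      where
      east-vanishes : ∀ i → suc m < i + i + x + y → east f p x y i ≡ + 0
      east-vanishes zero    _     = refl
      east-vanishes (suc i) short =
        cong (pairWeight p E *_) (f-short E (suc x) y i (≤-pred (subst (suc (suc m) ≤_) (east-bound i x y) short)))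
      north-vanishes : pairWeight p N * f N x (suc y) i ≡ + 0
      north-vanishes = trans (cong (pairWeight p N *_)
        (f-short N x (suc y) i (subst (suc m ≤_) (sym (south-bound i x y)) (m≤n⇒m≤1+n (<⇒≤ short)))))
        (*-zeroʳ (pairWeight p N))
      west-vanishes : ∀ x → suc m < i + i + x + y → west f p x y i ≡ + 0
      west-vanishes zero    _     = refl
      west-vanishes (suc x) short = trans (cong (pairWeight p W *_)
        (f-short W x y i (≤-pred (subst (suc (suc m) ≤_) (west-bound i x y) short)))) (*-zeroʳ (pairWeight p W))
      south-vanishes : ∀ y → suc m < i + i + x + y → south f p x y i ≡ + 0
      south-vanishes zero    _     = refl
      south-vanishes (suc y) short = trans (cong (pairWeight p S *_)
        (f-short S x y i (≤-pred (subst (suc (suc m) ≤_) (south-bound i x y) short)))) (*-zeroʳ (pairWeight p S))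

    walkSum-short : ∀ m p x y i → m < i + i + x + y → walkSum p x y i m ≡ + 0
    walkSum-short zero    p x y i short = trans (+ℤ-identityʳ _) (empty-walk x y i short)
      where
      empty-walk : ∀ x y i → 0 < i + i + x + y → loopWeight p x y i [] ≡ + 0
      empty-walk x       y       (suc i) _ rewrite ∧-zeroʳ (stays x y []) = refl
      empty-walk (suc x) y       zero    _ = refl
      empty-walk zero    (suc y) zero    _ = refl
    walkSum-short (suc m) p x y i short =
      trans (walkSum-suc p x y i m) (stepSum-vanishes m _ p x y i (λ q x y i → walkSum-short m q x y i) short)

    Qcoeff≡walkSum : ∀ i n → Qcoeff a i n ≡ walkSum W 0 0 i (2 ℕ.* n)
    Qcoeff≡walkSum i n = sumOver-filterᵇ (λ w → isLoop w ∧ (eSteps w ≡ᵇ i)) (λ w → a ^ cFactors w) (words (2 ℕ.* n))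

    Qcoeff-short : ∀ i n → n < i → Qcoeff a i n ≡ + 0
    Qcoeff-short i n n<i = trans (Qcoeff≡walkSum i n) (walkSum-short (2 ℕ.* n) W 0 0 i
      (subst₂ _<_ (cong (_+_ n) (sym (+-identityʳ n))) (sym (trans (+-identityʳ _) (+-identityʳ _))) (+-mono-< n<i n<i)))

module ClosedForm where

  open import Defs using (Step; E; N; W; S; Qcoeff; catalan)
  open Ballot
  open Walks
  open import Data.Nat using (ℕ; zero; suc)
  import Data.Nat as ℕ
  open import Data.Nat.Properties using (suc-injective; n<1+n; m≤n⇒m≤1+n)
  open import Data.Product using (_,_)
  open import Data.Integer using (ℤ; +_; _+_; _*_; _-_)
  open import Data.Integer.Properties using (*-zeroʳ; *-identityˡ; +-identityʳ; pos-+)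
  open import Data.Integer.Tactic.RingSolver
  open import Relation.Binary.PropositionalEquality

  -- In g-XY the horizontal path starts with X and the vertical one with Y;
  -- the a − 1 terms account for the factors ES and NW.
  module _
    (a : ℤ) (g : ℕ → ℕ → ℕ → ℕ → ℤ)
    (g-EN : ∀ x y i n → g x y (suc i) (suc n) ≡ g (suc x) y i (suc n) + g x (suc y) (suc i) n)
    (g-ES : ∀ x y i n → g x (suc y) (suc i) n ≡ g (suc x) (suc y) i n + g x y (suc i) n + (a - + 1) * g (suc x) y i n)
    (g-WN : ∀ x y i n → g (suc x) y i (suc n) ≡ g x y i (suc n) + g (suc x) (suc y) i n + (a - + 1) * g x (suc y) i n)
    (g-WS : ∀ x y i n → g (suc x) (suc y) i n ≡ g x (suc y) i n + g (suc x) y i n)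
    (g-vertical : ∀ y n → g 0 y 0 n ≡ + 1)
    (g-horizontal : ∀ x i → g x 0 i 0 ≡ + 1)
    where

    open Walks.Weighted a

    B O U D : ℕ → ℕ → ℤ
    B x i = + ballot x i
    O x i = + atOrigin x i
    U x i = + startUp x i
    D x i = + startDown x i

    B-first-step : ∀ x i → B x i ≡ O x i + U x i + D x i
    B-first-step x i = trans (cong +_ (ballot-first-step x i))
      (trans (pos-+ (atOrigin x i ℕ.+ startUp x i) (startDown x i)) (cong (_+ D x i) (pos-+ (atOrigin x i) (startUp x i))))

    gE gW gN gS gES gWN : ℕ → ℕ → ℕ → ℕ → ℤ
    gE  x       y       zero    n       = + 0
    gE  x       y       (suc i) n       = g (suc x) y i n
    gW  zero    y       i       n       = + 0
    gW  (suc x) y       i       n       = g x y i n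
    gN  x       y       i       zero    = + 0
    gN  x       y       i       (suc n) = g x (suc y) i n
    gS  x       zero    i       n       = + 0
    gS  x       (suc y) i       n       = g x y i n
    gES x       y       zero    n       = + 0
    gES x       y       (suc i) n       = gS (suc x) y i n
    gWN x       y       i       zero    = + 0
    gWN x       y       i       (suc n) = gW x (suc y) i n

    private
      cancel₂ : ∀ u v A B → u * v * (A + B - A - B) ≡ + 0
      cancel₂ = solve-∀
      cancel₃ : ∀ u v c A B C → u * v * (A + B + c * C - A - B - c * C) ≡ + 0
      cancel₃ = solve-∀

    up-up : ∀ x y i n → U x i * U y n * (g x y i n - gE x y i n - gN x y i n) ≡ + 0
    up-up x y zero    n       = refl
    up-up x y (suc i) zero    rewrite *-zeroʳ (U x (suc i)) = refl
    up-up x y (suc i) (suc n) rewrite g-EN x y i n =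
      cancel₂ (U x (suc i)) (U y (suc n)) (g (suc x) y i (suc n)) (g x (suc y) (suc i) n)

    up-down : ∀ x y i n → U x i * D y n * (g x y i n - gE x y i n - gS x y i n - (a - + 1) * gES x y i n) ≡ + 0
    up-down x zero    zero    n = refl
    up-down x (suc y) zero    n = refl
    up-down x zero    (suc i) n rewrite *-zeroʳ (U x (suc i)) = refl
    up-down x (suc y) (suc i) n rewrite g-ES x y i n =
      cancel₃ (U x (suc i)) (D (suc y) n) (a - + 1) (g (suc x) (suc y) i n) (g x y (suc i) n) (g (suc x) y i n)

    down-up : ∀ x y i n → D x i * U y n * (g x y i n - gW x y i n - gN x y i n - (a - + 1) * gWN x y i n) ≡ + 0
    down-up zero    y i zero    = refl
    down-up zero    y i (suc n) = refl
    down-up (suc x) y i zero    rewrite *-zeroʳ (D (suc x) i) = refl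
    down-up (suc x) y i (suc n) rewrite g-WN x y i n =
      cancel₃ (D (suc x) i) (U y (suc n)) (a - + 1) (g x y i (suc n)) (g (suc x) (suc y) i n) (g x (suc y) i n)

    down-down : ∀ x y i n → D x i * D y n * (g x y i n - gW x y i n - gS x y i n) ≡ + 0
    down-down zero    y       i n = refl
    down-down (suc x) zero    i n rewrite *-zeroʳ (D (suc x) i) = refl
    down-down (suc x) (suc y) i n rewrite g-WS x y i n =
      cancel₂ (D (suc x) i) (D (suc y) n) (g x (suc y) i n) (g (suc x) y i n)

    origin-up : ∀ x y i n → O x i * U y n * (g x y i n - gN x y i n) ≡ + 0
    origin-up (suc x) y i       n       = refl
    origin-up zero    y (suc i) n       = refl
    origin-up zero    y zero    zero    = refl
    origin-up zero    y zero    (suc n) rewrite g-vertical y (suc n) | g-vertical (suc y) n =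
      *-zeroʳ (+ 1 * U y (suc n))

    origin-down : ∀ x y i n → O x i * D y n * (g x y i n - gS x y i n) ≡ + 0
    origin-down (suc x) y       i       n = refl
    origin-down zero    y       (suc i) n = refl
    origin-down zero    zero    zero    n = refl
    origin-down zero    (suc y) zero    n rewrite g-vertical (suc y) n | g-vertical y n =
      *-zeroʳ (+ 1 * D (suc y) n)

    up-origin : ∀ x y i n → U x i * O y n * (g x y i n - gE x y i n) ≡ + 0
    up-origin x zero    zero    n       = refl
    up-origin x (suc y) zero    n       = refl
    up-origin x (suc y) (suc i) n       rewrite *-zeroʳ (U x (suc i)) = refl
    up-origin x zero    (suc i) (suc n) rewrite *-zeroʳ (U x (suc i)) = refl
    up-origin x zero    (suc i) zero    rewrite g-horizontal x (suc i) | g-horizontal (suc x) i =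
      *-zeroʳ (U x (suc i) * + 1)

    down-origin : ∀ x y i n → D x i * O y n * (g x y i n - gW x y i n) ≡ + 0
    down-origin zero    y       i n       = refl
    down-origin (suc x) (suc y) i n       rewrite *-zeroʳ (D (suc x) i) = refl
    down-origin (suc x) zero    i (suc n) rewrite *-zeroʳ (D (suc x) i) = refl
    down-origin (suc x) zero    i zero    rewrite g-horizontal (suc x) i | g-horizontal x i =
      *-zeroʳ (D (suc x) i * + 1)

    origin-origin : ∀ m x y i n → walkLength x y i n ≡ suc m → O x i * O y n * g x y i n ≡ + 0
    origin-origin m (suc x) y       i       n       _ = refl
    origin-origin m zero    y       (suc i) n       _ = refl
    origin-origin m zero    (suc y) zero    n       _ = refl
    origin-origin m zero    zero    zero    (suc n) _ = refl

    eastTerm northTerm westTerm southTerm : ℕ → ℕ → ℕ → ℕ → ℤ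
    eastTerm  x y i n = U x i * B y n * gE x y i n + (a - + 1) * (U x i * D y n * gES x y i n)
    northTerm x y i n = B x i * U y n * gN x y i n + (a - + 1) * (D x i * U y n * gWN x y i n)
    westTerm  x y i n = D x i * B y n * gW x y i n
    southTerm x y i n = B x i * D y n * gS x y i n

    private
      expand : ∀ a Ox Ux Dx Oy Uy Dy g gE gW gN gS gES gWN →
        (Ox + Ux + Dx) * (Oy + Uy + Dy) * g ≡
          (Ux * (Oy + Uy + Dy) * gE + (a - + 1) * (Ux * Dy * gES))
          + ((Ox + Ux + Dx) * Uy * gN + (a - + 1) * (Dx * Uy * gWN))
          + Dx * (Oy + Uy + Dy) * gW + (Ox + Ux + Dx) * Dy * gS
          + (Ux * Uy * (g - gE - gN) + Ux * Dy * (g - gE - gS - (a - + 1) * gES)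
             + Dx * Uy * (g - gW - gN - (a - + 1) * gWN) + Dx * Dy * (g - gW - gS)
             + Ox * Uy * (g - gN) + Ox * Dy * (g - gS) + Ux * Oy * (g - gE) + Dx * Oy * (g - gW)
             + Ox * Oy * g)
      expand = solve-∀

      drop-vanishing : ∀ X {e₁ e₂ e₃ e₄ e₅ e₆ e₇ e₈ e₉} →
        e₁ ≡ + 0 → e₂ ≡ + 0 → e₃ ≡ + 0 → e₄ ≡ + 0 → e₅ ≡ + 0 → e₆ ≡ + 0 → e₇ ≡ + 0 → e₈ ≡ + 0 → e₉ ≡ + 0 →
        X + (e₁ + e₂ + e₃ + e₄ + e₅ + e₆ + e₇ + e₈ + e₉) ≡ X
      drop-vanishing X refl refl refl refl refl refl refl refl refl = +-identityʳ X

      first-step-identity : ∀ a Bx Ox Ux Dx By Oy Uy Dy g gE gW gN gS gES gWN →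
        Bx ≡ Ox + Ux + Dx → By ≡ Oy + Uy + Dy →
        Ux * Uy * (g - gE - gN) ≡ + 0 → Ux * Dy * (g - gE - gS - (a - + 1) * gES) ≡ + 0 →
        Dx * Uy * (g - gW - gN - (a - + 1) * gWN) ≡ + 0 → Dx * Dy * (g - gW - gS) ≡ + 0 →
        Ox * Uy * (g - gN) ≡ + 0 → Ox * Dy * (g - gS) ≡ + 0 → Ux * Oy * (g - gE) ≡ + 0 → Dx * Oy * (g - gW) ≡ + 0 →
        Ox * Oy * g ≡ + 0 →
        Bx * By * g ≡ (Ux * By * gE + (a - + 1) * (Ux * Dy * gES)) + (Bx * Uy * gN + (a - + 1) * (Dx * Uy * gWN))
                      + Dx * By * gW + Bx * Dy * gS
      first-step-identity a _ Ox Ux Dx _ Oy Uy Dy g gE gW gN gS gES gWN refl refl h₁ h₂ h₃ h₄ h₅ h₆ h₇ h₈ h₉ =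
        trans (expand a Ox Ux Dx Oy Uy Dy g gE gW gN gS gES gWN) (drop-vanishing _ h₁ h₂ h₃ h₄ h₅ h₆ h₇ h₈ h₉)

    -- Both ballot numbers split by the first step of their path; each of the nine resulting
    -- products either matches one recurrence of g or vanishes.
    first-step : ∀ m x y i n → walkLength x y i n ≡ suc m →
      B x i * B y n * g x y i n ≡ eastTerm x y i n + northTerm x y i n + westTerm x y i n + southTerm x y i n
    first-step m x y i n len =
      first-step-identity a (B x i) (O x i) (U x i) (D x i) (B y n) (O y n) (U y n) (D y n)
        (g x y i n) (gE x y i n) (gW x y i n) (gN x y i n) (gS x y i n) (gES x y i n) (gWN x y i n)
        (B-first-step x i) (B-first-step y n)
        (up-up x y i n) (up-down x y i n) (down-up x y i n) (down-down x y i n)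
        (origin-up x y i n) (origin-down x y i n) (up-origin x y i n) (down-origin x y i n) (origin-origin m x y i n len)

    closedForm : Step → ℕ → ℕ → ℕ → ℕ → ℤ
    closedForm p x y i n = B x i * B y n * g x y i n
      + (pairWeight p S - + 1) * southTerm x y i n + (pairWeight p W - + 1) * westTerm x y i n

    private
      regroup : ∀ e n w s cW cS → e + (n + (cW * w + cS * s)) ≡ e + n + w + s + (cS - + 1) * s + (cW - + 1) * w
      regroup = solve-∀
      empty-identity : ∀ c c' → + 1 ≡ + 1 * + 1 * + 1 + c * + 0 + c' * + 0
      empty-identity = solve-∀
      vanishes : ∀ c b d u v → + 0 ≡ b * + 0 * u + c * (d * + 0 * v)
      vanishes = solve-∀
      vanishes′ : ∀ c b u → + 0 ≡ c * (b * + 0 * u)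
      vanishes′ = solve-∀

    empty-walk : ∀ p → walkSum p 0 0 0 0 ≡ closedForm p 0 0 0 0
    empty-walk p = trans (empty-walkSum p) (trans (empty-identity (pairWeight p S - + 1) (pairWeight p W - + 1))
      (cong (λ t → + 1 * + 1 * t + (pairWeight p S - + 1) * + 0 + (pairWeight p W - + 1) * + 0) (sym (g-vertical 0 0))))
      where
      empty-walkSum : ∀ p → walkSum p 0 0 0 0 ≡ + 1
      empty-walkSum E = refl
      empty-walkSum N = refl
      empty-walkSum W = refl
      empty-walkSum S = refl

    walkSum-closedForm : ∀ m p x y i n → walkLength x y i n ≡ m → walkSum p x y i m ≡ closedForm p x y i n
    walkSum-closedForm zero    p x y i n len with walkLength≡0 x y i n len
    ... | refl , refl , refl , refl = empty-walk p
    walkSum-closedForm (suc m) p x y i n len = begin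
        walkSum p x y i (suc m)
      ≡⟨ walkSum-suc p x y i m ⟩
        stepSum (λ q x y i → walkSum q x y i m) p x y i
      ≡⟨ cong₂ _+_ (east-closed i len)
           (cong₂ _+_ (north-closed n len) (cong₂ _+_ (west-closed x len) (south-closed y len))) ⟩
        eastTerm x y i n + (northTerm x y i n + (pairWeight p W * westTerm x y i n + pairWeight p S * southTerm x y i n))
      ≡⟨ regroup (eastTerm x y i n) (northTerm x y i n) (westTerm x y i n) (southTerm x y i n)
                 (pairWeight p W) (pairWeight p S) ⟩
        eastTerm x y i n + northTerm x y i n + westTerm x y i n + southTerm x y i n
          + (pairWeight p S - + 1) * southTerm x y i n + (pairWeight p W - + 1) * westTerm x y i n
      ≡⟨ cong (λ t → t + (pairWeight p S - + 1) * southTerm x y i n + (pairWeight p W - + 1) * westTerm x y i n)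
              (sym (first-step m x y i n len)) ⟩
        closedForm p x y i n
      ∎
      where
      open ≡-Reasoning
      walks : Continuation
      walks q x y i = walkSum q x y i m

      east-closed : ∀ i → walkLength x y i n ≡ suc m → east walks p x y i ≡ eastTerm x y i n
      east-closed zero    _   = cong (_+_ (+ 0)) (sym (*-zeroʳ (a - + 1)))
      east-closed (suc i) len = trans (*-identityˡ _) (trans
        (walkSum-closedForm m E (suc x) y i n (suc-injective (trans (sym (walkLength-E x y i n)) len))) (+-identityʳ _))

      north-closed : ∀ n → walkLength x y i n ≡ suc m → pairWeight p N * walks N x (suc y) i ≡ northTerm x y i n
      north-closed zero    len = trans (cong (+ 1 *_) (walkSum-short m N x (suc y) i short))
        (vanishes (a - + 1) (B x i) (D x i) (gN x y i 0) (gWN x y i 0))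
        where
        short : m ℕ.< i ℕ.+ i ℕ.+ x ℕ.+ suc y
        short = subst (m ℕ.<_) (sym (walkLength-S x y i 0)) (subst (λ l → m ℕ.< suc l) (sym len) (m≤n⇒m≤1+n (n<1+n m)))
      north-closed (suc n) len = trans (*-identityˡ _) (trans
        (walkSum-closedForm m N x (suc y) i n (suc-injective (trans (sym (walkLength-N x y i n)) len)))
        (cong (_+ (a - + 1) * westTerm x (suc y) i n) (+-identityʳ (B x i * B (suc y) n * g x (suc y) i n))))

      west-closed : ∀ x → walkLength x y i n ≡ suc m → west walks p x y i ≡ pairWeight p W * westTerm x y i n
      west-closed zero    _   = sym (*-zeroʳ (pairWeight p W))
      west-closed (suc x) len = cong (pairWeight p W *_) (trans
        (walkSum-closedForm m W x y i n (suc-injective (trans (sym (walkLength-W x y i n)) len)))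
        (trans (+-identityʳ _) (+-identityʳ _)))

      south-closed : ∀ y → walkLength x y i n ≡ suc m → south walks p x y i ≡ pairWeight p S * southTerm x y i n
      south-closed zero    _   = vanishes′ (pairWeight p S) (B x i) (gS x 0 i n)
      south-closed (suc y) len = cong (pairWeight p S *_) (trans
        (walkSum-closedForm m S x y i n (suc-injective (trans (sym (walkLength-S x y i n)) len)))
        (trans (+-identityʳ _) (+-identityʳ _)))

    Qcoeff-closedForm : ∀ i j → Qcoeff a i (i ℕ.+ j) ≡ + catalan i * + catalan j * g 0 0 i j
    Qcoeff-closedForm i j = begin
        Qcoeff a i (i ℕ.+ j)
      ≡⟨ Qcoeff≡walkSum i (i ℕ.+ j) ⟩
        walkSum W 0 0 i (2 ℕ.* (i ℕ.+ j))
      ≡⟨ walkSum-closedForm (2 ℕ.* (i ℕ.+ j)) W 0 0 i j (walkLength-origin i j) ⟩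
        B 0 i * B 0 j * g 0 0 i j + + 0 + + 0
      ≡⟨ trans (+-identityʳ _) (+-identityʳ _) ⟩
        B 0 i * B 0 j * g 0 0 i j
      ≡⟨ cong₂ (λ p q → + p * + q * g 0 0 i j) (sym (catalan≡ballot i)) (sym (catalan≡ballot j)) ⟩
        + catalan i * + catalan j * g 0 0 i j
      ∎
      where open ≡-Reasoning

module ShufflesAtOne where

  open Walks using (walkLength; walkLength-E; walkLength-N; walkLength-W; walkLength-S)
  open import Data.Nat using (ℕ; suc)
  import Data.Nat as ℕ
  open import Data.Nat.Properties using (+-identityʳ)
  import Data.Nat.Tactic.RingSolver as ℕ-Solver
  open import Data.Nat.Combinatorics using (_C_; nCk+nC[k+1]≡[n+1]C[k+1]; nCn≡1)
  open import Data.Integer using (ℤ; +_; _+_; _*_; _-_)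
  open import Data.Integer.Properties using (pos-+) renaming (+-identityʳ to +ℤ-identityʳ)
  open import Relation.Binary.PropositionalEquality

  -- The walk interleaves its 2i + x horizontal steps with its vertical ones in any order.
  shuffles : ℕ → ℕ → ℕ → ℕ → ℤ
  shuffles x y i n = + (walkLength x y i n C (i ℕ.+ i ℕ.+ x))

  private
    pascal : ∀ {L K L₁ K₁ L₂ K₂ L′ K′} → L ≡ suc L′ → K ≡ suc K′ → L₁ ≡ L′ → K₁ ≡ K′ → L₂ ≡ L′ → K₂ ≡ suc K′ →
      + (L C K) ≡ + (L₁ C K₁) + + (L₂ C K₂)
    pascal {L′ = L′} {K′} refl refl refl refl refl refl =
      trans (cong +_ (sym (nCk+nC[k+1]≡[n+1]C[k+1] L′ K′))) (pos-+ (L′ C K′) (L′ C suc K′))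

    horizontal-E : ∀ i x → suc i ℕ.+ suc i ℕ.+ x ≡ suc (i ℕ.+ i ℕ.+ suc x)
    horizontal-E = ℕ-Solver.solve-∀
    horizontal-W : ∀ i x → i ℕ.+ i ℕ.+ suc x ≡ suc (i ℕ.+ i ℕ.+ x)
    horizontal-W = ℕ-Solver.solve-∀

  shuffles-EN : ∀ x y i n → shuffles x y (suc i) (suc n) ≡ shuffles (suc x) y i (suc n) + shuffles x (suc y) (suc i) n
  shuffles-EN x y i n = pascal (walkLength-E x y i (suc n)) (horizontal-E i x) refl refl
    (trans (walkLength-E x (suc y) i n) (sym (walkLength-N (suc x) y i n))) (horizontal-E i x)

  shuffles-ES : ∀ x y i n → shuffles x (suc y) (suc i) n
    ≡ shuffles (suc x) (suc y) i n + shuffles x y (suc i) n + (+ 1 - + 1) * shuffles (suc x) y i n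
  shuffles-ES x y i n = trans (pascal (walkLength-E x (suc y) i n) (horizontal-E i x) refl refl
    (trans (walkLength-E x y i n) (sym (walkLength-S (suc x) y i n))) (horizontal-E i x)) (sym (+ℤ-identityʳ _))

  shuffles-WN : ∀ x y i n → shuffles (suc x) y i (suc n)
    ≡ shuffles x y i (suc n) + shuffles (suc x) (suc y) i n + (+ 1 - + 1) * shuffles x (suc y) i n
  shuffles-WN x y i n = trans (pascal (walkLength-W x y i (suc n)) (horizontal-W i x) refl refl
    (trans (walkLength-W x (suc y) i n) (sym (walkLength-N x y i n))) (horizontal-W i x)) (sym (+ℤ-identityʳ _))

  shuffles-WS : ∀ x y i n → shuffles (suc x) (suc y) i n ≡ shuffles x (suc y) i n + shuffles (suc x) y i n
  shuffles-WS x y i n = pascal (walkLength-W x (suc y) i n) (horizontal-W i x) refl refl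
    (trans (walkLength-W x y i n) (sym (walkLength-S x y i n))) (horizontal-W i x)

  shuffles-vertical : ∀ y n → shuffles 0 y 0 n ≡ + 1
  shuffles-vertical y n = refl

  shuffles-horizontal : ∀ x i → shuffles x 0 i 0 ≡ + 1
  shuffles-horizontal x i =
    cong +_ (trans (cong (_C (i ℕ.+ i ℕ.+ x)) (+-identityʳ (i ℕ.+ i ℕ.+ x))) (nCn≡1 (i ℕ.+ i ℕ.+ x)))

module ShufflesAtMinusOne where

  open import Data.Nat using (ℕ; zero; suc; _<_; s≤s)
  import Data.Nat as ℕ
  open import Data.Nat.Properties using (m<n⇒m<1+n; n<1+n; +-suc; +-assoc) renaming (+-identityʳ to +ℕ-identityʳ)
  open import Data.Nat.Combinatorics using (_C_; nCk+nC[k+1]≡[n+1]C[k+1])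
  open import Data.Integer using (ℤ; +_; _+_; _*_; _-_; -_)
  open import Data.Integer.Properties using (+-identityˡ; *-identityˡ; *-zeroʳ; *-assoc; *-distribˡ-+; pos-+)
  open import Data.Integer.Tactic.RingSolver
  open import Relation.Binary.PropositionalEquality

  -- coeff a b m is the coefficient of t ^ m in (1 + t) ^ a * (1 - t) ^ b.
  coeff : ℕ → ℕ → ℕ → ℤ
  coeff zero    zero    zero    = + 1
  coeff zero    zero    (suc m) = + 0
  coeff zero    (suc b) zero    = coeff zero b zero
  coeff zero    (suc b) (suc m) = coeff zero b (suc m) - coeff zero b m
  coeff (suc a) b       zero    = coeff a b zero
  coeff (suc a) b       (suc m) = coeff a b (suc m) + coeff a b m

  alternating : ℕ → ℤ
  alternating zero    = + 1
  alternating (suc k) = - alternating k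

  alternating-square : ∀ k → alternating k * alternating k ≡ + 1
  alternating-square zero    = refl
  alternating-square (suc k) = trans (neg-square (alternating k)) (alternating-square k)
    where
    neg-square : ∀ p → (- p) * (- p) ≡ p * p
    neg-square = solve-∀

  coeff-zero : ∀ a b → coeff a b 0 ≡ + 1
  coeff-zero zero    zero    = refl
  coeff-zero zero    (suc b) = coeff-zero zero b
  coeff-zero (suc a) b       = coeff-zero a b

  coeff-suc-b : ∀ a b m → coeff a (suc b) (suc m) ≡ coeff a b (suc m) - coeff a b m
  coeff-suc-b zero    b zero    = refl
  coeff-suc-b zero    b (suc m) = refl
  coeff-suc-b (suc a) b zero    =
    trans (cong₂ _+_ (coeff-suc-b a b zero) (trans (coeff-zero a (suc b)) (sym (coeff-zero a b))))
      (shuffle (coeff a b 1) (coeff a b 0))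
    where
    shuffle : ∀ p q → p - q + q ≡ p + q - q
    shuffle = solve-∀
  coeff-suc-b (suc a) b (suc m) =
    trans (cong₂ _+_ (coeff-suc-b a b (suc m)) (coeff-suc-b a b m))
      (shuffle (coeff a b (suc (suc m))) (coeff a b (suc m)) (coeff a b m))
    where
    shuffle : ∀ p q r → p - q + (q - r) ≡ p + q - (q + r)
    shuffle = solve-∀

  -- 1 - t = 2 - (1 + t)
  coeff-two : ∀ a b m → coeff a (suc b) m ≡ coeff a b m + coeff a b m - coeff (suc a) b m
  coeff-two a b zero    rewrite coeff-zero a (suc b) | coeff-zero a b = refl
  coeff-two a b (suc m) rewrite coeff-suc-b a b m = shuffle (coeff a b (suc m)) (coeff a b m)
    where
    shuffle : ∀ p q → p - q ≡ p + p - (p + q)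
    shuffle = solve-∀

  coeff-high : ∀ a b m → a ℕ.+ b < m → coeff a b m ≡ + 0
  coeff-high zero    zero    (suc m) _         = refl
  coeff-high zero    (suc b) (suc m) (s≤s b<m)
    rewrite coeff-high zero b (suc m) (m<n⇒m<1+n b<m) | coeff-high zero b m b<m = refl
  coeff-high (suc a) b       (suc m) (s≤s a+b<m)
    rewrite coeff-high a b (suc m) (m<n⇒m<1+n a+b<m) | coeff-high a b m a+b<m = refl

  coeff-top : ∀ a b → coeff a b (a ℕ.+ b) ≡ alternating b
  coeff-top zero    zero    = refl
  coeff-top zero    (suc b) rewrite coeff-high zero b (suc b) (n<1+n b) | coeff-top zero b = +-identityˡ _
  coeff-top (suc a) b       rewrite coeff-high a b (suc (a ℕ.+ b)) (n<1+n _) | coeff-top a b = +-identityˡ _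

  -- (1 + t) ^ A (1 - t) ^ A = (1 - t²) ^ A
  coeff-diagonal-suc : ∀ A m → coeff (suc A) (suc A) (suc (suc m)) ≡ coeff A A (suc (suc m)) - coeff A A m
  coeff-diagonal-suc A m =
    trans (cong₂ _+_ (coeff-suc-b A A (suc m)) (coeff-suc-b A A m))
      (telescope (coeff A A (suc (suc m))) (coeff A A (suc m)) (coeff A A m))
    where
    telescope : ∀ p q r → p - q + (q - r) ≡ p - r
    telescope = solve-∀

  coeff-diagonal-odd : ∀ A j → coeff A A (suc (j ℕ.+ j)) ≡ + 0
  coeff-diagonal-odd zero    j       = refl
  coeff-diagonal-odd (suc A) zero    =
    trans (cong₂ _+_ (coeff-suc-b A A 0) (trans (coeff-zero A (suc A)) (sym (coeff-zero A A))))
      (trans (cancel (coeff A A 1) (coeff A A 0)) (coeff-diagonal-odd A 0))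
    where
    cancel : ∀ p q → p - q + q ≡ p
    cancel = solve-∀
  coeff-diagonal-odd (suc A) (suc j) rewrite +-suc j j =
    trans (coeff-diagonal-suc A (suc (j ℕ.+ j)))
      (cong₂ _-_ (subst (λ k → coeff A A (suc (suc k)) ≡ + 0) (+-suc j j) (coeff-diagonal-odd A (suc j)))
                 (coeff-diagonal-odd A j))

  coeff-diagonal-even : ∀ A j → coeff A A (j ℕ.+ j) ≡ alternating j * + (A C j)
  coeff-diagonal-even zero    zero    = refl
  coeff-diagonal-even zero    (suc j) = sym (*-zeroʳ (alternating (suc j)))
  coeff-diagonal-even (suc A) zero    = coeff-zero (suc A) (suc A)
  coeff-diagonal-even (suc A) (suc j) rewrite +-suc j j =
    trans (coeff-diagonal-suc A (j ℕ.+ j))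
      (trans (cong₂ _-_ (subst (λ k → coeff A A (suc k) ≡ alternating (suc j) * + (A C suc j)) (+-suc j j)
                               (coeff-diagonal-even A (suc j)))
                        (coeff-diagonal-even A j))
        (trans (pascal-signed (alternating j) (+ (A C j)) (+ (A C suc j)))
          (cong (alternating (suc j) *_) (trans (sym (pos-+ (A C j) (A C suc j))) (cong +_ (nCk+nC[k+1]≡[n+1]C[k+1] A j))))))
    where
    pascal-signed : ∀ s p q → (- s) * q - s * p ≡ (- s) * (p + q)
    pascal-signed = solve-∀

  private
    σ : ℕ → ℕ → ℤ
    σ n y = alternating (n ℕ.+ y)
    A : ℕ → ℕ → ℕ
    A i n = i ℕ.+ n
    B : ℕ → ℕ → ℕ → ℕ → ℕ
    B x y i n = i ℕ.+ x ℕ.+ (n ℕ.+ y)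
    M : ℕ → ℕ → ℕ
    M y n = n ℕ.+ n ℕ.+ y

  signedShuffles : ℕ → ℕ → ℕ → ℕ → ℤ
  signedShuffles x y i n = σ n y * coeff (A i n) (B x y i n) (M y n)

  shape-in : ∀ x y i n → signedShuffles x y (suc i) (suc n)
    ≡ - σ n y * coeff (suc (suc (A i n))) (suc (suc (B x y i n))) (suc (suc (M y n)))
  shape-in x y i n rewrite +-suc i n | +-suc (i ℕ.+ x) (n ℕ.+ y) | +-suc n n = refl

  shape-xn : ∀ x y i n → signedShuffles (suc x) y i (suc n)
    ≡ - σ n y * coeff (suc (A i n)) (suc (suc (B x y i n))) (suc (suc (M y n)))
  shape-xn x y i n rewrite +-suc i n | +-suc i x | +-suc (i ℕ.+ x) (n ℕ.+ y) | +-suc n n = refl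

  shape-yi : ∀ x y i n → signedShuffles x (suc y) (suc i) n
    ≡ - σ n y * coeff (suc (A i n)) (suc (suc (B x y i n))) (suc (M y n))
  shape-yi x y i n rewrite +-suc n y | +-suc (i ℕ.+ x) (n ℕ.+ y) | +-suc (n ℕ.+ n) y = refl

  shape-xy : ∀ x y i n → signedShuffles (suc x) (suc y) i n
    ≡ - σ n y * coeff (A i n) (suc (suc (B x y i n))) (suc (M y n))
  shape-xy x y i n rewrite +-suc n y | +-suc i x | +-suc (i ℕ.+ x) (n ℕ.+ y) | +-suc (n ℕ.+ n) y = refl

  shape-x : ∀ x y i n → signedShuffles (suc x) y i n ≡ σ n y * coeff (A i n) (suc (B x y i n)) (M y n)
  shape-x x y i n rewrite +-suc i x = refl

  shape-n : ∀ x y i n → signedShuffles x y i (suc n)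
    ≡ - σ n y * coeff (suc (A i n)) (suc (B x y i n)) (suc (suc (M y n)))
  shape-n x y i n rewrite +-suc i n | +-suc (i ℕ.+ x) (n ℕ.+ y) | +-suc n n = refl

  shape-y : ∀ x y i n → signedShuffles x (suc y) i n ≡ - σ n y * coeff (A i n) (suc (B x y i n)) (suc (M y n))
  shape-y x y i n rewrite +-suc n y | +-suc (i ℕ.+ x) (n ℕ.+ y) | +-suc (n ℕ.+ n) y = refl

  private
    step-ES : ∀ s p q r t → q ≡ t + t - r → (- s) * (p + q) ≡ (- s) * p + s * r + (- + 1 - + 1) * (s * t)
    step-ES s p _ r t refl = identity s p r t
      where
      identity : ∀ s p r t → (- s) * (p + (t + t - r)) ≡ (- s) * p + s * r + (- + 1 - + 1) * (s * t)
      identity = solve-∀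

    step-WN : ∀ s p q r t → r ≡ t + t - q → (- s) * (p - q) ≡ (- s) * p + (- s) * r + (- + 1 - + 1) * ((- s) * t)
    step-WN s p q _ t refl = identity s p q t
      where
      identity : ∀ s p q t → (- s) * (p - q) ≡ (- s) * p + (- s) * (t + t - q) + (- + 1 - + 1) * ((- s) * t)
      identity = solve-∀

    step-WS : ∀ s p q → (- s) * (p - q) ≡ (- s) * p + s * q
    step-WS = solve-∀

  signed-EN : ∀ x y i n →
    signedShuffles x y (suc i) (suc n) ≡ signedShuffles (suc x) y i (suc n) + signedShuffles x (suc y) (suc i) n
  signed-EN x y i n = trans (shape-in x y i n)
    (trans (*-distribˡ-+ (- σ n y) (coeff (suc (A i n)) (suc (suc (B x y i n))) (suc (suc (M y n))))
                                   (coeff (suc (A i n)) (suc (suc (B x y i n))) (suc (M y n))))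
      (sym (cong₂ _+_ (shape-xn x y i n) (shape-yi x y i n))))

  signed-ES : ∀ x y i n → signedShuffles x (suc y) (suc i) n
    ≡ signedShuffles (suc x) (suc y) i n + signedShuffles x y (suc i) n + (- + 1 - + 1) * signedShuffles (suc x) y i n
  signed-ES x y i n = trans (shape-yi x y i n)
    (trans (step-ES (σ n y) (coeff (A i n) (suc (suc (B x y i n))) (suc (M y n)))
                    (coeff (A i n) (suc (suc (B x y i n))) (M y n))
                    (coeff (suc (A i n)) (suc (B x y i n)) (M y n)) (coeff (A i n) (suc (B x y i n)) (M y n))
                    (coeff-two (A i n) (suc (B x y i n)) (M y n)))
      (sym (cong₂ _+_ (cong₂ _+_ (shape-xy x y i n) refl) (cong ((- + 1 - + 1) *_) (shape-x x y i n)))))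

  signed-WN : ∀ x y i n → signedShuffles (suc x) y i (suc n)
    ≡ signedShuffles x y i (suc n) + signedShuffles (suc x) (suc y) i n + (- + 1 - + 1) * signedShuffles x (suc y) i n
  signed-WN x y i n = trans (shape-xn x y i n)
    (trans (cong (- σ n y *_) (coeff-suc-b (suc (A i n)) (suc (B x y i n)) (suc (M y n))))
    (trans (step-WN (σ n y) (coeff (suc (A i n)) (suc (B x y i n)) (suc (suc (M y n))))
                    (coeff (suc (A i n)) (suc (B x y i n)) (suc (M y n))) (coeff (A i n) (suc (suc (B x y i n))) (suc (M y n)))
                    (coeff (A i n) (suc (B x y i n)) (suc (M y n))) (coeff-two (A i n) (suc (B x y i n)) (suc (M y n))))
      (sym (cong₂ _+_ (cong₂ _+_ (shape-n x y i n) (shape-xy x y i n)) (cong ((- + 1 - + 1) *_) (shape-y x y i n))))))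

  signed-WS : ∀ x y i n → signedShuffles (suc x) (suc y) i n ≡ signedShuffles x (suc y) i n + signedShuffles (suc x) y i n
  signed-WS x y i n = trans (shape-xy x y i n)
    (trans (cong (- σ n y *_) (coeff-suc-b (A i n) (suc (B x y i n)) (M y n)))
    (trans (step-WS (σ n y) (coeff (A i n) (suc (B x y i n)) (suc (M y n))) (coeff (A i n) (suc (B x y i n)) (M y n)))
      (sym (cong₂ _+_ (shape-y x y i n) (shape-x x y i n)))))

  signed-vertical : ∀ y n → signedShuffles 0 y 0 n ≡ + 1
  signed-vertical y n rewrite +-assoc n n y | coeff-top n (n ℕ.+ y) = alternating-square (n ℕ.+ y)

  signed-horizontal : ∀ x i → signedShuffles x 0 i 0 ≡ + 1
  signed-horizontal x i rewrite coeff-zero (i ℕ.+ 0) (i ℕ.+ x ℕ.+ 0) = refl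

  signed-origin : ∀ i j → signedShuffles 0 0 i j ≡ + ((i ℕ.+ j) C j)
  signed-origin i j rewrite +ℕ-identityʳ i | +ℕ-identityʳ j | +ℕ-identityʳ (j ℕ.+ j) | coeff-diagonal-even (i ℕ.+ j) j =
    trans (sym (*-assoc (alternating j) (alternating j) _))
      (trans (cong (_* + ((i ℕ.+ j) C j)) (alternating-square j)) (*-identityˡ _))

module CatalanConvolution where

  open import Defs using (catalan)
  open Binomials
  open Ballot using (catalan-central)
  open import Data.Nat using (ℕ; zero; suc; _+_; _*_; _∸_; _≤_; _<_; _!; NonZero; z≤n; s≤s)
  open import Data.Nat.Properties
    using (+-identityʳ; +-assoc; +-suc; +-comm; *-distribʳ-+; *-distribˡ-+; *-zeroʳ; *-cancelʳ-≡; n<1+n; ≤-pred;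
           m+[n∸m]≡n; m+n∸m≡n;
           _!≢0; _!*_!≢0; +-commutativeSemigroup)
  open import Data.Nat.Combinatorics using (_C_; nCk+nC[k+1]≡[n+1]C[k+1]; k>n⇒nCk≡0)
  open import Data.Nat.Tactic.RingSolver using (solve-∀)
  open import Algebra.Properties.CommutativeSemigroup +-commutativeSemigroup using (interchange; x∙yz≈y∙xz)
  open import Relation.Binary.PropositionalEquality
  open ≡-Reasoning

  sumℕ< : ℕ → (ℕ → ℕ) → ℕ
  sumℕ< zero    f = 0
  sumℕ< (suc n) f = f 0 + sumℕ< n (λ i → f (suc i))

  sumℕ<-cong : ∀ n {f g : ℕ → ℕ} → (∀ i → i < n → f i ≡ g i) → sumℕ< n f ≡ sumℕ< n g
  sumℕ<-cong zero    f≗g = refl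
  sumℕ<-cong (suc n) f≗g = cong₂ _+_ (f≗g 0 (s≤s z≤n)) (sumℕ<-cong n (λ i i<n → f≗g (suc i) (s≤s i<n)))

  sumℕ<-+ : ∀ n (f g : ℕ → ℕ) → sumℕ< n (λ i → f i + g i) ≡ sumℕ< n f + sumℕ< n g
  sumℕ<-+ zero    f g = refl
  sumℕ<-+ (suc n) f g = trans (cong (f 0 + g 0 +_) (sumℕ<-+ n _ _)) (interchange (f 0) (g 0) _ _)

  sumℕ<-*ˡ : ∀ n c (f : ℕ → ℕ) → sumℕ< n (λ i → c * f i) ≡ c * sumℕ< n f
  sumℕ<-*ˡ zero    c f = sym (*-zeroʳ c)
  sumℕ<-*ˡ (suc n) c f = trans (cong (c * f 0 +_) (sumℕ<-*ˡ n c _)) (sym (*-distribˡ-+ c (f 0) _))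

  sumℕ<-*ʳ : ∀ n c (f : ℕ → ℕ) → sumℕ< n (λ i → f i * c) ≡ sumℕ< n f * c
  sumℕ<-*ʳ zero    c f = refl
  sumℕ<-*ʳ (suc n) c f = trans (cong (f 0 * c +_) (sumℕ<-*ʳ n c _)) (sym (*-distribʳ-+ c (f 0) _))

  sumℕ<-last : ∀ n (f : ℕ → ℕ) → sumℕ< (suc n) f ≡ sumℕ< n f + f n
  sumℕ<-last zero    f = +-identityʳ (f 0)
  sumℕ<-last (suc n) f = trans (cong (f 0 +_) (sumℕ<-last n (λ i → f (suc i)))) (sym (+-assoc (f 0) _ _))

  vandermonde : ∀ a b c → sumℕ< (suc a) (λ i → (a C i) * (b C (c + i))) ≡ (a + b) C (a + c)
  vandermonde zero    b c = trans (+-identityʳ _) (trans (+-identityʳ _) (cong (b C_) (+-identityʳ c)))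
  vandermonde (suc a) b c = begin
      1 * (b C (c + 0)) + sumℕ< (suc a) (λ i → (suc a C suc i) * (b C (c + suc i)))
    ≡⟨ cong (1 * (b C (c + 0)) +_) (trans (sumℕ<-cong (suc a) (λ i _ → pascal i))
         (sumℕ<-+ (suc a) (λ i → (a C i) * (b C (c + suc i))) (λ i → f (suc i)))) ⟩
      1 * (b C (c + 0)) + (sumℕ< (suc a) (λ i → (a C i) * (b C (c + suc i))) + sumℕ< (suc a) (λ i → f (suc i)))
    ≡⟨ cong (λ s → 1 * (b C (c + 0)) + (s + sumℕ< (suc a) (λ i → f (suc i))))
            (trans (sumℕ<-cong (suc a) (λ i _ → cong (λ k → (a C i) * (b C k)) (+-suc c i))) (vandermonde a b (suc c))) ⟩
      1 * (b C (c + 0)) + ((a + b) C (a + suc c) + sumℕ< (suc a) (λ i → f (suc i)))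
    ≡⟨ x∙yz≈y∙xz (1 * (b C (c + 0))) ((a + b) C (a + suc c)) _ ⟩
      (a + b) C (a + suc c) + sumℕ< (suc (suc a)) f
    ≡⟨ cong ((a + b) C (a + suc c) +_) (trans (sumℕ<-last (suc a) f) (trans
         (cong (sumℕ< (suc a) f +_) (cong (_* (b C (c + suc a))) (k>n⇒nCk≡0 (n<1+n a))))
         (trans (+-identityʳ _) (vandermonde a b c)))) ⟩
      (a + b) C (a + suc c) + (a + b) C (a + c)
    ≡⟨ trans (+-comm ((a + b) C (a + suc c)) _) (cong (λ k → (a + b) C (a + c) + (a + b) C k) (+-suc a c)) ⟩
      (a + b) C (a + c) + (a + b) C suc (a + c)
    ≡⟨ nCk+nC[k+1]≡[n+1]C[k+1] (a + b) (a + c) ⟩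
      (suc a + b) C (suc a + c)
    ∎
    where
    f : ℕ → ℕ
    f i = (a C i) * (b C (c + i))
    pascal : ∀ i → (suc a C suc i) * (b C (c + suc i)) ≡ (a C i) * (b C (c + suc i)) + f (suc i)
    pascal i = trans (cong (_* (b C (c + suc i))) (sym (nCk+nC[k+1]≡[n+1]C[k+1] a i))) (*-distribʳ-+ _ (a C i) (a C suc i))

  catalan-factorial : ∀ k → catalan k * (k ! * suc k !) ≡ (k + k) !
  catalan-factorial k =
    trans (regroup (catalan k) k (k !)) (trans (cong (_* (k ! * k !)) (catalan-central k)) (C-factorial k k))
    where
    regroup : ∀ c k f → c * (f * (suc k * f)) ≡ c * suc k * (f * f)
    regroup = solve-∀

  convolution-term : ∀ i j →
    ((i + i + (j + j)) C (i + i)) * catalan i * catalan j * ((i + j) ! * suc (suc (i + j)) !)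
      ≡ (i + i + (j + j)) ! * (((i + j) C i) * (suc (suc (i + j)) C suc i))
  convolution-term i j =
    factorials ((i + i + (j + j)) C (i + i)) (catalan i) (catalan j) ((i + j) C i) (suc (suc (i + j)) C suc i)
      (i !) (suc i !) (j !) (suc j !)
      (catalan-factorial i) (catalan-factorial j) (C-factorial (i + i) (j + j)) (C-factorial i j)
      (subst (λ n → (n C suc i) * (suc i ! * suc j !) ≡ n !) (cong suc (+-suc i j)) (C-factorial (suc i) (suc j)))
    where
    factorials : ∀ c c₁ c₂ b₁ b₂ f₁ f₁′ f₂ f₂′ {P Q R M M′} →
      c₁ * (f₁ * f₁′) ≡ Q → c₂ * (f₂ * f₂′) ≡ R → c * (Q * R) ≡ P →
      b₁ * (f₁ * f₂) ≡ M → b₂ * (f₁′ * f₂′) ≡ M′ →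
      c * c₁ * c₂ * (M * M′) ≡ P * (b₁ * b₂)
    factorials c c₁ c₂ b₁ b₂ f₁ f₁′ f₂ f₂′ refl refl refl refl refl = regroup c c₁ c₂ b₁ b₂ f₁ f₁′ f₂ f₂′
      where
      regroup : ∀ c c₁ c₂ b₁ b₂ f₁ f₁′ f₂ f₂′ →
        c * c₁ * c₂ * (b₁ * (f₁ * f₂) * (b₂ * (f₁′ * f₂′)))
          ≡ c * (c₁ * (f₁ * f₁′) * (c₂ * (f₂ * f₂′))) * (b₁ * b₂)
      regroup = solve-∀

  catalan-product : ∀ n → catalan n * catalan (suc n) * (n ! * suc (suc n) !) ≡ (n + n) ! * ((suc n + suc n) C suc n)
  catalan-product n = factorials (catalan n) (catalan (suc n)) (n !) (suc n !) (suc (suc n) !) ((suc n + suc n) C suc n)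
    {{suc n !≢0}} (catalan-factorial n) (catalan-factorial (suc n)) (C-factorial (suc n) (suc n))
    where
    factorials : ∀ c₀ c₁ f F G b {X Y} → .{{NonZero F}} →
      c₀ * (f * F) ≡ Y → c₁ * (F * G) ≡ X → b * (F * F) ≡ X → c₀ * c₁ * (f * G) ≡ Y * b
    factorials c₀ c₁ f F G b refl refl e = *-cancelʳ-≡ _ _ F
      (trans (regroup₁ c₀ c₁ f F G) (trans (cong (c₀ * f *_) (sym e)) (sym (regroup₂ c₀ f F b))))
      where
      regroup₁ : ∀ c₀ c₁ f F G → c₀ * c₁ * (f * G) * F ≡ c₀ * f * (c₁ * (F * G))
      regroup₁ = solve-∀
      regroup₂ : ∀ c₀ f F b → c₀ * (f * F) * b * F ≡ c₀ * f * (b * (F * F))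
      regroup₂ = solve-∀

  catalan-convolution : ∀ n →
    sumℕ< (suc n) (λ i → ((2 * n) C (2 * i)) * catalan i * catalan (n ∸ i)) ≡ catalan n * catalan (suc n)
  catalan-convolution n = *-cancelʳ-≡ _ _ (n ! * suc (suc n) !) {{n !* suc (suc n) !≢0}} (begin
      sumℕ< (suc n) term * K
    ≡⟨ sym (sumℕ<-*ʳ (suc n) K term) ⟩
      sumℕ< (suc n) (λ i → term i * K)
    ≡⟨ sumℕ<-cong (suc n) (λ i i≤n → term-factorials i (≤-pred i≤n)) ⟩
      sumℕ< (suc n) (λ i → (n + n) ! * ((n C i) * (suc (suc n) C suc i)))
    ≡⟨ sumℕ<-*ˡ (suc n) ((n + n) !) (λ i → (n C i) * (suc (suc n) C suc i)) ⟩
      (n + n) ! * sumℕ< (suc n) (λ i → (n C i) * (suc (suc n) C suc i))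
    ≡⟨ cong ((n + n) ! *_) (trans (vandermonde n (suc (suc n)) 1) (cong₂ _C_ (+-suc n (suc n)) (+-comm n 1))) ⟩
      (n + n) ! * ((suc n + suc n) C suc n)
    ≡⟨ sym (catalan-product n) ⟩
      catalan n * catalan (suc n) * K
    ∎)
    where
    K : ℕ
    K = n ! * suc (suc n) !
    term : ℕ → ℕ
    term i = ((2 * n) C (2 * i)) * catalan i * catalan (n ∸ i)
    term-factorials : ∀ i → i ≤ n → term i * K ≡ (n + n) ! * ((n C i) * (suc (suc n) C suc i))
    term-factorials i i≤n = subst (λ n → ((2 * n) C (2 * i)) * catalan i * catalan (n ∸ i) * (n ! * suc (suc n) !)
                                           ≡ (n + n) ! * ((n C i) * (suc (suc n) C suc i)))
                                  (m+[n∸m]≡n i≤n) (at (n ∸ i))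
      where
      at : ∀ j → ((2 * (i + j)) C (2 * i)) * catalan i * catalan (i + j ∸ i) * ((i + j) ! * suc (suc (i + j)) !)
                   ≡ (i + j + (i + j)) ! * (((i + j) C i) * (suc (suc (i + j)) C suc i))
      at j = begin
          ((2 * (i + j)) C (2 * i)) * catalan i * catalan (i + j ∸ i) * ((i + j) ! * suc (suc (i + j)) !)
        ≡⟨ cong₂ (λ m k → (m C k) * catalan i * catalan (i + j ∸ i) * ((i + j) ! * suc (suc (i + j)) !))
                 (double-sum i j) (double i) ⟩
          ((i + i + (j + j)) C (i + i)) * catalan i * catalan (i + j ∸ i) * ((i + j) ! * suc (suc (i + j)) !)
        ≡⟨ cong (λ k → ((i + i + (j + j)) C (i + i)) * catalan i * catalan k * ((i + j) ! * suc (suc (i + j)) !))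
                (m+n∸m≡n i j) ⟩
          ((i + i + (j + j)) C (i + i)) * catalan i * catalan j * ((i + j) ! * suc (suc (i + j)) !)
        ≡⟨ convolution-term i j ⟩
          (i + i + (j + j)) ! * (((i + j) C i) * (suc (suc (i + j)) C suc i))
        ≡⟨ cong (λ m → m ! * (((i + j) C i) * (suc (suc (i + j)) C suc i))) (rearrange i j) ⟩
          (i + j + (i + j)) ! * (((i + j) C i) * (suc (suc (i + j)) C suc i))
        ∎
        where
        double-sum : ∀ i j → 2 * (i + j) ≡ i + i + (j + j)
        double-sum = solve-∀
        double : ∀ i → 2 * i ≡ i + i
        double = solve-∀
        rearrange : ∀ i j → i + i + (j + j) ≡ i + j + (i + j)
        rearrange = solve-∀

module Coefficients where

  open import Defs
  open ListSums
  open Walks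
  open ShufflesAtOne
  open ShufflesAtMinusOne
  open Binomials using (C-symmetric)
  open CatalanConvolution using (sumℕ<; catalan-convolution)
  open import Function using (id)
  open import Data.Bool using (_∧_; if_then_else_)
  open import Data.Nat using (ℕ; zero; suc; _≡ᵇ_; _≤_; _∸_)
  import Data.Nat as ℕ
  open import Data.Nat.Properties using (≤-pred; m+[n∸m]≡n; m+n∸m≡n; *-distribˡ-+; *-cancelˡ-≤)
  import Data.Nat.Tactic.RingSolver as ℕ-Solver
  open import Data.Nat.Combinatorics using (_C_)
  open import Data.List using (List; map; upTo; length)
  open import Data.List.Properties using (map-cong; map-cong-local)
  open import Data.List.Relation.Unary.All as All using ()
  open import Data.List.Relation.Unary.All.Properties using (applyUpTo⁺₁)
  open import Data.Integer using (ℤ; +_; -_; _+_; _*_; _^_)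
  open import Data.Integer.Properties using (pos-*; pos-+)
  open import Data.Integer.Tactic.RingSolver using (solve-∀)
  open import Relation.Binary.PropositionalEquality
  open ≡-Reasoning

  private
    pos-product : ∀ p q r → + p * + q * + r ≡ + (r ℕ.* p ℕ.* q)
    pos-product p q r = trans (rotate (+ p) (+ q) (+ r)) (trans (cong (_* + q) (sym (pos-* r p))) (sym (pos-* (r ℕ.* p) q)))
      where
      rotate : ∀ p q r → p * q * r ≡ r * p * q
      rotate = solve-∀

  Qcoeff-at-one : ∀ i j →
    Qcoeff (+ 1) i (i ℕ.+ j) ≡ + (((2 ℕ.* i ℕ.+ 2 ℕ.* j) C (2 ℕ.* i)) ℕ.* catalan i ℕ.* catalan j)
  Qcoeff-at-one i j = begin
      Qcoeff (+ 1) i (i ℕ.+ j)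
    ≡⟨ ClosedForm.Qcoeff-closedForm (+ 1) shuffles
         shuffles-EN shuffles-ES shuffles-WN shuffles-WS shuffles-vertical shuffles-horizontal i j ⟩
      + catalan i * + catalan j * + (walkLength 0 0 i j C (i ℕ.+ i ℕ.+ 0))
    ≡⟨ cong (λ c → + catalan i * + catalan j * + c) (cong₂ _C_ (length-split i j) (double i)) ⟩
      + catalan i * + catalan j * + ((2 ℕ.* i ℕ.+ 2 ℕ.* j) C (2 ℕ.* i))
    ≡⟨ pos-product (catalan i) (catalan j) _ ⟩
      + (((2 ℕ.* i ℕ.+ 2 ℕ.* j) C (2 ℕ.* i)) ℕ.* catalan i ℕ.* catalan j)
    ∎
    where
    length-split : ∀ i j → i ℕ.+ i ℕ.+ 0 ℕ.+ (j ℕ.+ j ℕ.+ 0) ≡ 2 ℕ.* i ℕ.+ 2 ℕ.* j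
    length-split = ℕ-Solver.solve-∀
    double : ∀ i → i ℕ.+ i ℕ.+ 0 ≡ 2 ℕ.* i
    double = ℕ-Solver.solve-∀

  Qcoeff-at-minus-one : ∀ i j → Qcoeff (- (+ 1)) i (i ℕ.+ j) ≡ + (((i ℕ.+ j) C i) ℕ.* catalan i ℕ.* catalan j)
  Qcoeff-at-minus-one i j = begin
      Qcoeff (- (+ 1)) i (i ℕ.+ j)
    ≡⟨ ClosedForm.Qcoeff-closedForm (- (+ 1)) signedShuffles
         signed-EN signed-ES signed-WN signed-WS signed-vertical signed-horizontal i j ⟩
      + catalan i * + catalan j * signedShuffles 0 0 i j
    ≡⟨ cong (+ catalan i * + catalan j *_) (trans (signed-origin i j) (cong +_ (sym (C-symmetric i j)))) ⟩
      + catalan i * + catalan j * + ((i ℕ.+ j) C i)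
    ≡⟨ pos-product (catalan i) (catalan j) _ ⟩
      + (((i ℕ.+ j) C i) ℕ.* catalan i ℕ.* catalan j)
    ∎

  QcoeffU-sum : ∀ a n → QcoeffU a n ≡ sumℤ (map (λ i → Qcoeff a i n) (upTo (suc n)))
  QcoeffU-sum a n = begin
      QcoeffU a n
    ≡⟨ sumOver-filterᵇ isLoop weight (words (2 ℕ.* n)) ⟩
      sumOver (words (2 ℕ.* n)) (λ w → if isLoop w then weight w else + 0)
    ≡⟨ cong sumℤ (map-cong-local (All.map (λ {w} → split-by-east-steps w) (words-length (2 ℕ.* n)))) ⟩
      sumOver (words (2 ℕ.* n)) (λ w → sumOver (upTo (suc n)) (λ i → loop-with i w))
    ≡⟨ sumOver-comm (words (2 ℕ.* n)) (upTo (suc n)) (λ w i → loop-with i w) ⟩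
      sumOver (upTo (suc n)) (λ i → sumOver (words (2 ℕ.* n)) (loop-with i))
    ≡⟨ cong sumℤ (map-cong (λ i → sym (sumOver-filterᵇ (λ w → isLoop w ∧ (eSteps w ≡ᵇ i)) weight (words (2 ℕ.* n))))
                           (upTo (suc n))) ⟩
      sumℤ (map (λ i → Qcoeff a i n) (upTo (suc n)))
    ∎
    where
    weight : List Step → ℤ
    weight w = a ^ cFactors w
    loop-with : ℕ → List Step → ℤ
    loop-with i w = if isLoop w ∧ (eSteps w ≡ᵇ i) then weight w else + 0
    split-by-east-steps : ∀ w → length w ≡ 2 ℕ.* n →
      (if isLoop w then weight w else + 0) ≡ sumOver (upTo (suc n)) (λ i → loop-with i w)
    split-by-east-steps w len = sym (trans (sumOver-applyUpTo (λ i → loop-with i w) id (suc n))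
      (sumℤ<-indicator (isLoop w) (weight w) (eSteps w) n
        (λ loop → *-cancelˡ-≤ 2 (subst₂ _≤_ (double (eSteps w)) len (stays⇒eSteps≤length 0 0 w loop)))))
      where
      double : ∀ e → e ℕ.+ e ℕ.+ 0 ≡ 2 ℕ.* e
      double = ℕ-Solver.solve-∀

  QcoeffU-at-one : ∀ n →
    QcoeffU (+ 1) n ≡ sumℤ (map (λ i → + (((2 ℕ.* n) C (2 ℕ.* i)) ℕ.* catalan i ℕ.* catalan (n ∸ i))) (upTo (suc n)))
  QcoeffU-at-one n =
    trans (QcoeffU-sum (+ 1) n) (cong sumℤ (map-cong-local (applyUpTo⁺₁ id (suc n) (λ i<1+n → below (≤-pred i<1+n)))))
    where
    below : ∀ {i} → i ≤ n → Qcoeff (+ 1) i n ≡ + (((2 ℕ.* n) C (2 ℕ.* i)) ℕ.* catalan i ℕ.* catalan (n ∸ i))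
    below {i} i≤n = subst (λ n → Qcoeff (+ 1) i n ≡ + (((2 ℕ.* n) C (2 ℕ.* i)) ℕ.* catalan i ℕ.* catalan (n ∸ i)))
      (m+[n∸m]≡n i≤n)
      (trans (Qcoeff-at-one i (n ∸ i)) (cong₂ (λ m j → + ((m C (2 ℕ.* i)) ℕ.* catalan i ℕ.* catalan j))
        (sym (*-distribˡ-+ 2 i (n ∸ i))) (sym (m+n∸m≡n i (n ∸ i)))))

  sumℤ<-pos : ∀ n (f : ℕ → ℕ) → sumℤ< n (λ i → + f i) ≡ + sumℕ< n f
  sumℤ<-pos zero    f = refl
  sumℤ<-pos (suc n) f = trans (cong (_+_ (+ f 0)) (sumℤ<-pos n (λ i → f (suc i)))) (sym (pos-+ (f 0) _))

  QcoeffU-product : ∀ n → QcoeffU (+ 1) n ≡ + (catalan n ℕ.* catalan (suc n))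
  QcoeffU-product n = begin
      QcoeffU (+ 1) n
    ≡⟨ QcoeffU-at-one n ⟩
      sumℤ (map (λ i → + term i) (upTo (suc n)))
    ≡⟨ sumOver-applyUpTo (λ i → + term i) id (suc n) ⟩
      sumℤ< (suc n) (λ i → + term i)
    ≡⟨ sumℤ<-pos (suc n) term ⟩
      + sumℕ< (suc n) term
    ≡⟨ cong +_ (catalan-convolution n) ⟩
      + (catalan n ℕ.* catalan (suc n))
    ∎
    where
    term : ℕ → ℕ
    term i = ((2 ℕ.* n) C (2 ℕ.* i)) ℕ.* catalan i ℕ.* catalan (n ∸ i)

open import Defs
open import Data.Nat using (ℕ; suc; _+_; _*_; _<_; _∸_)
open import Data.Nat.Combinatorics using (_C_)
open import Data.List using (map; upTo)
open import Data.Integer using (+_; -_)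
open import Data.Product using (_×_; _,_)
open import Relation.Binary.PropositionalEquality using (_≡_)
open Coefficients
open Walks.Weighted using (Qcoeff-short)

proposition4p6 :
    ((n : ℕ) → QcoeffU (+ 1) n
                 ≡ sumℤ (map (λ i → + (((2 * n) C (2 * i)) * catalan i * catalan (n ∸ i)))
                             (upTo (suc n))))
    × ((n : ℕ) → QcoeffU (+ 1) n ≡ + (catalan n * catalan (suc n)))
    × ((i j : ℕ) → Qcoeff (+ 1) i (i + j)
                   ≡ + (((2 * i + 2 * j) C (2 * i)) * catalan i * catalan j))
    × ((i n : ℕ) → n < i → Qcoeff (+ 1) i n ≡ + 0)
    × ((i j : ℕ) → Qcoeff (- (+ 1)) i (i + j)
                   ≡ + (((i + j) C i) * catalan i * catalan j))
    × ((i n : ℕ) → n < i → Qcoeff (- (+ 1)) i n ≡ + 0)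
proposition4p6 =
  QcoeffU-at-one , QcoeffU-product , Qcoeff-at-one , Qcoeff-short (+ 1) , Qcoeff-at-minus-one , Qcoeff-short (- (+ 1))
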